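{- For every integer $k>4$, \[\overline{\alpha}(\{1,4,k\})=\begin{cases}\frac{2k}{5k+5} & k\equiv0\pmod5,\\ \frac25 & k\equiv1\pmod5,\\ \frac{2k+1}{5k+5} & k\equiv2\pmod5,\\ \frac{2k-1}{5k+5} & k\equiv3\pmod5,\\ \frac25 & k\equiv4\pmod5.\end{cases}\]
   Context: For a finite set $S$ of positive integers, the distance graph $G(S)$ has vertex set $\mathbb{Z}$, with $i,j$ adjacent iff $|i-j|\in S$. For $A\subseteq\mathbb{Z}$, $\delta(A)=\limsup_{N\to\infty}\frac{|A\cap[-N,N]|}{2N+1}$. The independence ratio $\overline{\alpha}(S)$ is the supremum of $\delta(A)$ over all independent sets $A$ of $G(S)$. -}

module Defs where

open import Data.Bool using (Bool; true; false)
open import Data.Nat as ℕ using (ℕ; zero; suc; _%_)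
open import Data.Integer as ℤ using (ℤ; +_; -[1+_]; ∣_∣)
open import Data.Rational using (ℚ; _/_; _+_; _-_; _≤_; _<_; 0ℚ)
open import Data.List using (List; _∷_; [])
open import Data.List.Membership.Propositional using (_∈_)
open import Data.Product using (_×_; ∃-syntax; Σ-syntax)
open import Relation.Binary.PropositionalEquality using (_≡_)
open import Relation.Nullary using (¬_)

Subsetℤ : Set
Subsetℤ = ℤ → Bool

Independent : List ℕ → Subsetℤ → Set
Independent S A = ∀ (i j : ℤ) → A i ≡ true → A j ≡ true → ¬ (∣ i ℤ.- j ∣ ∈ S)

b2n : Bool → ℕ
b2n true  = 1
b2n false = 0

count : Subsetℤ → ℕ → ℕ
count A zero    = b2n (A (+ 0))
count A (suc N) = count A N ℕ.+ b2n (A (+ suc N)) ℕ.+ b2n (A -[1+ N ])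

density : Subsetℤ → ℕ → ℚ
density A N = (+ count A N) / suc (2 ℕ.* N)

UpperDensity≤ : Subsetℤ → ℚ → Set
UpperDensity≤ A r =
  ∀ (ε : ℚ) → 0ℚ < ε → ∃[ N₀ ] ∀ (N : ℕ) → N₀ ℕ.≤ N → density A N ≤ r + ε

-- r is the independence ratio of G(S), i.e. r is the supremum of the
-- upper densities of independent sets:
--  (1) every independent set has upper density ≤ r;
--  (2) for every ε > 0 some independent set has density > r - ε
--      for infinitely many N (hence upper density ≥ r - ε).
IsIndependenceRatio : List ℕ → ℚ → Set
IsIndependenceRatio S r =
  (∀ (A : Subsetℤ) → Independent S A → UpperDensity≤ A r)
  × (∀ (ε : ℚ) → 0ℚ < ε → Σ[ A ∈ Subsetℤ ] (Independent S A ×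
       (∀ (N₀ : ℕ) → ∃[ N ] (N₀ ℕ.≤ N × r - ε < density A N))))

ratio14k : ℕ → ℚ
ratio14k k with k % 5
... | 0 = (+ (2 ℕ.* k)) / suc (5 ℕ.* k ℕ.+ 4)
... | 1 = (+ 2) / 5
... | 2 = (+ (2 ℕ.* k ℕ.+ 1)) / suc (5 ℕ.* k ℕ.+ 4)
... | 3 = (+ (2 ℕ.* k ℕ.∸ 1)) / suc (5 ℕ.* k ℕ.+ 4)
... | _ = (+ 2) / 5

-- An independent set of G({1,4,k}) meets any five consecutive integers in at most two
-- points. For k = 5q and k = 5q + 2 the distance k moreover caps every window of length
-- k + 1 at 2q resp. 2q + 1 points, since a point at its start excludes its end. For
-- k = 5q + 3 the k places starting at a point can hold 2q + 2 points, but only with both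
-- end blocks of length 3 full, which empties the places k, ..., k + 3; so the window of
-- length k + 1 or k + 4 starting at a point has density at most (2q + 1) / (k + 1).
-- Covering [-N, N] greedily by such windows bounds the upper density. Conversely, a
-- pattern on ℤ/(k+1) (on ℤ/5 when k ≡ 1, 4 mod 5) with that many points and no two at
-- distance ±1, ±4 repeats periodically; since k ≡ -1 modulo k + 1, copying it to both
-- half-lines beyond a large offset gives an independent set of the same density.

module Submission where

open import Defs
open import Data.Bool using (Bool; true; false; T; _∧_; _∨_)
open import Data.Nat as ℕ
  using (ℕ; zero; suc; _+_; _*_; _∸_; _≤_; _<_; z≤n; s≤s; _%_; _≤ᵇ_; _<ᵇ_; _≡ᵇ_; NonZero)
import Data.Nat.Properties as ℕₚ
open import Data.Nat.DivMod
  using (%-distribˡ-+; m%n%n≡m%n; m%n<n; m<n⇒m%n≡m; [m+n]%n≡m%n; [m+kn]%n≡m%n; m≡m%n+[m/n]*n)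
import Data.Nat.Tactic.RingSolver as ℕ-Solver
open import Data.Integer as ℤ using (ℤ; +_; -[1+_]; +[1+_]; _⊖_)
import Data.Integer.Properties as ℤₚ
import Data.Integer.Tactic.RingSolver as ℤ-Solver
open import Data.Rational as ℚ using (ℚ; mkℚ; _/_; 0ℚ; toℚᵘ)
import Data.Rational.Properties as ℚₚ
open import Data.Rational.Unnormalised as ℚᵘ using (mkℚᵘ)
import Data.Rational.Unnormalised.Properties as ℚᵘₚ
open import Data.List using (List; _∷_; [])
open import Data.List.Membership.Propositional using (_∈_)
open import Data.List.Relation.Unary.Any using (here; there)
open import Data.Product using (_×_; _,_; ∃-syntax; Σ-syntax; proj₁; proj₂)
open import Data.Sum using (_⊎_; inj₁; inj₂) renaming (map to ⊎-map)
open import Data.Empty using (⊥; ⊥-elim)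
open import Relation.Nullary using (yes; no)
open import Relation.Binary.PropositionalEquality

tally : (ℕ → Bool) → ℕ → ℕ
tally f zero    = 0
tally f (suc L) = b2n (f 0) + tally (λ i → f (suc i)) L

shift : ℕ → (ℕ → Bool) → ℕ → Bool
shift L f i = f (L + i)

b2n≤1 : ∀ b → b2n b ≤ 1
b2n≤1 true  = s≤s z≤n
b2n≤1 false = z≤n

tally-+ : ∀ f L M → tally f (L + M) ≡ tally f L + tally (shift L f) M
tally-+ f zero    M = refl
tally-+ f (suc L) M = trans (cong (_+_ (b2n (f 0))) (tally-+ (λ i → f (suc i)) L M))
                            (sym (ℕₚ.+-assoc (b2n (f 0)) _ _))

tally-cong : ∀ f g L → (∀ i → i < L → f i ≡ g i) → tally f L ≡ tally g L
tally-cong f g zero    eq = refl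
tally-cong f g (suc L) eq = cong₂ _+_ (cong b2n (eq 0 (s≤s z≤n)))
  (tally-cong (λ i → f (suc i)) (λ i → g (suc i)) L (λ i i<L → eq (suc i) (s≤s i<L)))

tally-mono : ∀ f g L → (∀ i → i < L → f i ≡ true → g i ≡ true) → tally f L ≤ tally g L
tally-mono f g zero    f⊆g = z≤n
tally-mono f g (suc L) f⊆g = ℕₚ.+-mono-≤ head
  (tally-mono (λ i → f (suc i)) (λ i → g (suc i)) L (λ i i<L → f⊆g (suc i) (s≤s i<L)))
  where
  head : b2n (f 0) ≤ b2n (g 0)
  head with f 0 in f0
  ... | false = z≤n
  ... | true rewrite f⊆g 0 (s≤s z≤n) f0 = ℕₚ.≤-refl

tally-≤ : ∀ f L → tally f L ≤ L
tally-≤ f zero    = z≤n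
tally-≤ f (suc L) = ℕₚ.+-mono-≤ (b2n≤1 (f 0)) (tally-≤ (λ i → f (suc i)) L)

tally-≤-+ : ∀ f L M → tally f L ≤ tally f (L + M)
tally-≤-+ f L M = subst (tally f L ≤_) (sym (tally-+ f L M)) (ℕₚ.m≤m+n _ _)

tally-suc : ∀ f L → tally f (suc L) ≡ tally f L + b2n (f L)
tally-suc f L = begin
  tally f (suc L)                 ≡⟨ cong (tally f) (ℕₚ.+-comm 1 L) ⟩
  tally f (L + 1)                 ≡⟨ tally-+ f L 1 ⟩
  tally f L + (b2n (f (L + 0)) + 0) ≡⟨ cong (λ x → tally f L + (b2n (f x) + 0)) (ℕₚ.+-identityʳ L) ⟩
  tally f L + (b2n (f L) + 0)     ≡⟨ cong (_+_ (tally f L)) (ℕₚ.+-identityʳ _) ⟩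
  tally f L + b2n (f L)           ∎
  where open ≡-Reasoning

tally-periodic : ∀ f P → (∀ i → f (P + i) ≡ f i) → ∀ t → tally f (t * P) ≡ t * tally f P
tally-periodic f P per zero    = refl
tally-periodic f P per (suc t) = trans (tally-+ f P (t * P))
  (cong (_+_ (tally f P)) (trans (tally-cong (shift P f) f (t * P) (λ i _ → per i))
                              (tally-periodic f P per t)))

-- Sets avoiding the distances 1 and 4

Avoids : ℕ → (ℕ → Bool) → Set
Avoids d f = ∀ n → f n ≡ true → f (d + n) ≡ false

avoids-shift : ∀ {d f} L → Avoids d f → Avoids d (shift L f)
avoids-shift {d} {f} L av n fn = subst (λ x → f x ≡ false) (reorder d L n) (av (L + n) fn)
  where
  reorder : ∀ d L n → d + (L + n) ≡ L + (d + n)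
  reorder = ℕ-Solver.solve-∀

Avoids₁₄ : (ℕ → Bool) → Set
Avoids₁₄ f = Avoids 1 f × Avoids 4 f

avoids₁₄-shift : ∀ {f} L → Avoids₁₄ f → Avoids₁₄ (shift L f)
avoids₁₄-shift L (av₁ , av₄) = avoids-shift L av₁ , avoids-shift L av₄

tally-2 : ∀ f → Avoids 1 f → tally f 2 ≤ 1
tally-2 f av with f 0 in f0
... | false = ℕₚ.+-mono-≤ (b2n≤1 (f 1)) z≤n
... | true rewrite av 0 f0 = s≤s z≤n

tally-3 : ∀ f → Avoids 1 f → tally f 3 ≤ 2
tally-3 f av = ℕₚ.+-mono-≤ (b2n≤1 (f 0)) (tally-2 (shift 1 f) (avoids-shift 1 av))

tally-3-full : ∀ f → Avoids 1 f → 2 ≤ tally f 3 → f 0 ≡ true × f 2 ≡ true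
tally-3-full f av full with f 0 in f0
... | false = ⊥-elim (ℕₚ.<-irrefl refl (ℕₚ.≤-trans full (tally-2 (shift 1 f) (avoids-shift 1 av))))
... | true with f 2 in f2
...   | true = refl , refl
...   | false rewrite av 0 f0 with full
...     | s≤s ()

tally-4 : ∀ f → Avoids₁₄ f → tally f 4 ≤ 2
tally-4 f (av₁ , _) with f 0 in f0
... | false = tally-3 (shift 1 f) (avoids-shift 1 av₁)
... | true rewrite av₁ 0 f0 = s≤s (tally-2 (shift 2 f) (avoids-shift 2 av₁))

tally-5 : ∀ f → Avoids₁₄ f → tally f 5 ≤ 2
tally-5 f av@(av₁ , av₄) with f 0 in f0
... | false = tally-4 (shift 1 f) (avoids₁₄-shift 1 av)
... | true rewrite av₁ 0 f0 | av₄ 0 f0 = s≤s (tally-2 (shift 2 f) (avoids-shift 2 av₁))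

tally-5* : ∀ f → Avoids₁₄ f → ∀ m → tally f (m * 5) ≤ m * 2
tally-5* f av zero    = z≤n
tally-5* f av (suc m) = subst (_≤ suc m * 2) (sym (tally-+ f 5 (m * 5)))
  (ℕₚ.+-mono-≤ (tally-5 f av) (tally-5* (shift 5 f) (avoids₁₄-shift 5 av) m))

tally-5*+ : ∀ f → Avoids₁₄ f → ∀ m r c → tally (shift (m * 5) f) r ≤ c → tally f (m * 5 + r) ≤ m * 2 + c
tally-5*+ f av m r c tail = subst (_≤ m * 2 + c) (sym (tally-+ f (m * 5) r))
  (ℕₚ.+-mono-≤ (tally-5* f av m) tail)

-- Upper bound

SparseStart : ℕ → ℕ → ℕ → (ℕ → Bool) → Set
SparseStart P c B g = (g 0 ≡ false) ⊎ (Σ[ s ∈ ℕ ] (1 ≤ s × s ≤ B × tally g s * P ≤ c * s))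

-- Greedy decomposition of [0, L) into blocks of density ≤ c / P; only the last block,
-- which may overshoot L, costs the error term B * P.
module _ (Good : (ℕ → Bool) → Set) (good-shift : ∀ {g} L → Good g → Good (shift L g))
         (P c B : ℕ) (sparse : ∀ g → Good g → SparseStart P c B g) where

  open ℕₚ.≤-Reasoning

  tally-sparse : ∀ L g → Good g → tally g L * P ≤ c * L + B * P
  tally-sparse L g = go L L g ℕₚ.≤-refl
    where
    go : ∀ fuel L g → L ≤ fuel → Good g → tally g L * P ≤ c * L + B * P
    go _          zero    g _         _  = z≤n
    go (suc fuel) (suc L) g (s≤s L≤fuel) gg with sparse g gg
    ... | inj₁ g0 rewrite g0 = begin
      tally (shift 1 g) L * P ≤⟨ go fuel L (shift 1 g) L≤fuel (good-shift 1 gg) ⟩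
      c * L + B * P          ≤⟨ ℕₚ.+-monoˡ-≤ (B * P) (ℕₚ.*-monoʳ-≤ c (ℕₚ.n≤1+n L)) ⟩
      c * suc L + B * P      ∎
    ... | inj₂ (s , 1≤s , s≤B , block) with s ℕₚ.≤? suc L
    ...   | yes s≤L = subst (λ x → tally g x * P ≤ c * x + B * P) (ℕₚ.m+[n∸m]≡n s≤L) (begin
      tally g (s + R) * P                          ≡⟨ cong (_* P) (tally-+ g s R) ⟩
      (tally g s + tally (shift s g) R) * P         ≡⟨ ℕₚ.*-distribʳ-+ P (tally g s) _ ⟩
      tally g s * P + tally (shift s g) R * P       ≤⟨ ℕₚ.+-mono-≤ block (go fuel R (shift s g) R≤fuel (good-shift s gg)) ⟩
      c * s + (c * R + B * P)                      ≡⟨ regroup c s R (B * P) ⟩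
      c * (s + R) + B * P                          ∎)
      where
      R = suc L ∸ s
      R≤fuel : R ≤ fuel
      R≤fuel = ℕₚ.≤-trans (ℕₚ.∸-monoʳ-≤ (suc L) 1≤s) L≤fuel
      regroup : ∀ c s R X → c * s + (c * R + X) ≡ c * (s + R) + X
      regroup = ℕ-Solver.solve-∀
    ...   | no s≰L = begin
      tally g (suc L) * P ≤⟨ ℕₚ.*-monoˡ-≤ P (tally-≤ g (suc L)) ⟩
      suc L * P           ≤⟨ ℕₚ.*-monoˡ-≤ P (ℕₚ.≤-trans (ℕₚ.<⇒≤ (ℕₚ.≰⇒> s≰L)) s≤B) ⟩
      B * P               ≤⟨ ℕₚ.m≤n+m (B * P) (c * suc L) ⟩
      c * suc L + B * P   ∎

Avoids₁₄ₖ : ℕ → (ℕ → Bool) → Set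
Avoids₁₄ₖ k g = Avoids₁₄ g × Avoids k g

avoids₁₄ₖ-shift : ∀ k {g} L → Avoids₁₄ₖ k g → Avoids₁₄ₖ k (shift L g)
avoids₁₄ₖ-shift k L (av , avₖ) = avoids₁₄-shift L av , avoids-shift L avₖ

tally-start-false : ∀ g L → g 0 ≡ false → tally g (suc L) ≡ tally (shift 1 g) L
tally-start-false g L g0 = cong (λ x → b2n x + tally (shift 1 g) L) g0

tally-start-true : ∀ k g → Avoids k g → g 0 ≡ true → tally g (suc k) ≡ tally g k
tally-start-true k g avₖ g0 = begin
  tally g (suc k)          ≡⟨ tally-suc g k ⟩
  tally g k + b2n (g k)     ≡⟨ cong (λ i → tally g k + b2n (g i)) (sym (ℕₚ.+-identityʳ k)) ⟩
  tally g k + b2n (g (k + 0)) ≡⟨ cong (λ b → tally g k + b2n b) (avₖ 0 g0) ⟩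
  tally g k + 0            ≡⟨ ℕₚ.+-identityʳ _ ⟩
  tally g k                ∎
  where open ≡-Reasoning

-- An element at 0 excludes k, so a window of length k + 1 holds no more than one of length k.
tally-suc-k : ∀ k c → (∀ f → Avoids₁₄ f → tally f k ≤ c) → ∀ g → Avoids₁₄ₖ k g → tally g (suc k) ≤ c
tally-suc-k k c bound g (av , avₖ) = by-start (g 0) refl
  where
  by-start : ∀ b → g 0 ≡ b → tally g (suc k) ≤ c
  by-start false g0 = subst (_≤ c) (sym (tally-start-false g k g0)) (bound (shift 1 g) (avoids₁₄-shift 1 av))
  by-start true  g0 = subst (_≤ c) (sym (tally-start-true k g avₖ g0)) (bound g av)

block-sparse : ∀ P c g → tally g (suc P) ≤ c → SparseStart (suc P) c (suc P) g
block-sparse P c g bound = inj₂ (suc P , s≤s z≤n , ℕₚ.≤-refl , ℕₚ.*-monoˡ-≤ (suc P) bound)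

sparse-5 : ∀ g → Avoids₁₄ g → SparseStart 5 2 5 g
sparse-5 g av = block-sparse 4 2 g (tally-5 g av)

sparse-5q : ∀ q g → Avoids₁₄ₖ (q * 5) g → SparseStart (suc (q * 5)) (q * 2) (suc (q * 5)) g
sparse-5q q g av = block-sparse (q * 5) (q * 2) g
  (tally-suc-k (q * 5) (q * 2) (λ f av₁₄ → tally-5* f av₁₄ q) g av)

sparse-5q+2 : ∀ q g → Avoids₁₄ₖ (q * 5 + 2) g → SparseStart (suc (q * 5 + 2)) (q * 2 + 1) (suc (q * 5 + 2)) g
sparse-5q+2 q g av = block-sparse (q * 5 + 2) (q * 2 + 1) g
  (tally-suc-k (q * 5 + 2) (q * 2 + 1)
    (λ f av₁₄ → tally-5*+ f av₁₄ q 2 1 (tally-2 (shift (q * 5) f) (avoids-shift (q * 5) (proj₁ av₁₄)))) g av)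

tally-5q+3-full : ∀ f → Avoids₁₄ f → ∀ q → q * 2 + 2 ≤ tally f (q * 5 + 3) →
                  f 2 ≡ true × f (q * 5) ≡ true × f (q * 5 + 2) ≡ true
tally-5q+3-full f av@(av₁ , _) q full =
  proj₂ (tally-3-full f av₁ head-full) ,
  subst (λ i → f i ≡ true) (ℕₚ.+-identityʳ (q * 5)) (proj₁ (tally-3-full (shift (q * 5) f) (avoids-shift (q * 5) av₁) tail-full)) ,
  proj₂ (tally-3-full (shift (q * 5) f) (avoids-shift (q * 5) av₁) tail-full)
  where
  head-full : 2 ≤ tally f 3
  head-full = ℕₚ.+-cancelʳ-≤ (q * 2) 2 (tally f 3) (begin
    2 + q * 2                          ≡⟨ ℕₚ.+-comm 2 (q * 2) ⟩
    q * 2 + 2                          ≤⟨ full ⟩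
    tally f (q * 5 + 3)                ≡⟨ cong (tally f) (ℕₚ.+-comm (q * 5) 3) ⟩
    tally f (3 + q * 5)                ≡⟨ tally-+ f 3 (q * 5) ⟩
    tally f 3 + tally (shift 3 f) (q * 5) ≤⟨ ℕₚ.+-monoʳ-≤ (tally f 3) (tally-5* (shift 3 f) (avoids₁₄-shift 3 av) q) ⟩
    tally f 3 + q * 2                  ∎)
    where open ℕₚ.≤-Reasoning
  tail-full : 2 ≤ tally (shift (q * 5) f) 3
  tail-full = ℕₚ.+-cancelˡ-≤ (q * 2) 2 _ (begin
    q * 2 + 2                                   ≤⟨ full ⟩
    tally f (q * 5 + 3)                         ≡⟨ tally-+ f (q * 5) 3 ⟩
    tally f (q * 5) + tally (shift (q * 5) f) 3 ≤⟨ ℕₚ.+-monoˡ-≤ _ (tally-5* f av q) ⟩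
    q * 2 + tally (shift (q * 5) f) 3           ∎)
    where open ℕₚ.≤-Reasoning

sparse-5q+3 : ∀ q → 1 ≤ q → ∀ g → Avoids₁₄ₖ (q * 5 + 3) g →
              SparseStart (suc (q * 5 + 3)) (q * 2 + 1) (q * 5 + 3 + 4) g
sparse-5q+3 q 1≤q g (av@(av₁ , av₄) , avₖ) = by-start (g 0) refl
  where
  k = q * 5 + 3
  excluded-by-4 : ∀ i j → 4 + i ≡ j → g i ≡ true → g j ≡ false
  excluded-by-4 i j refl gi = av₄ i gi
  step₁ : ∀ q → 4 + q * 5 ≡ q * 5 + 3 + 1
  step₁ = ℕ-Solver.solve-∀
  step₃ : ∀ q → 4 + (q * 5 + 2) ≡ q * 5 + 3 + 3
  step₃ = ℕ-Solver.solve-∀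
  by-start : ∀ b → g 0 ≡ b → SparseStart (suc k) (q * 2 + 1) (k + 4) g
  by-start false g0 = inj₁ g0
  by-start true  g0 with tally g k ℕₚ.≤? q * 2 + 1
  ... | yes few = inj₂ (suc k , s≤s z≤n , subst (_≤ k + 4) (ℕₚ.+-comm k 1) (ℕₚ.+-monoʳ-≤ k (s≤s z≤n)) ,
                        ℕₚ.*-monoˡ-≤ (suc k) (subst (_≤ q * 2 + 1) (sym (tally-start-true k g avₖ g0)) few))
  ... | no many = inj₂ (k + 4 , ℕₚ.≤-trans (s≤s z≤n) (ℕₚ.m≤n+m 4 k) , ℕₚ.≤-refl , long-block)
    where
    full : q * 2 + 2 ≤ tally g k
    full = subst (_≤ tally g k) (sym (ℕₚ.+-suc (q * 2) 1)) (ℕₚ.≰⇒> many)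
    elements = tally-5q+3-full g av q full
    gap : tally (shift k g) 4 ≡ 0
    gap rewrite avₖ 0 g0
              | excluded-by-4 (q * 5) (k + 1) (step₁ q) (proj₁ (proj₂ elements))
              | avₖ 2 (proj₁ elements)
              | excluded-by-4 (q * 5 + 2) (k + 3) (step₃ q) (proj₂ (proj₂ elements)) = refl
    long-block-density : ∀ q → 1 ≤ q → (q * 2 + 2) * suc (q * 5 + 3) ≤ (q * 2 + 1) * (q * 5 + 3 + 4)
    long-block-density (suc q) _ = subst ((suc q * 2 + 2) * suc (suc q * 5 + 3) ≤_) (expand q) (ℕₚ.m≤m+n _ q)
      where
      expand : ∀ q → (suc q * 2 + 2) * suc (suc q * 5 + 3) + q ≡ (suc q * 2 + 1) * (suc q * 5 + 3 + 4)
      expand = ℕ-Solver.solve-∀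
    long-block : tally g (k + 4) * suc k ≤ (q * 2 + 1) * (k + 4)
    long-block = begin
      tally g (k + 4) * suc k                   ≡⟨ cong (λ x → x * suc k) (tally-+ g k 4) ⟩
      (tally g k + tally (shift k g) 4) * suc k ≡⟨ cong (λ x → (tally g k + x) * suc k) gap ⟩
      (tally g k + 0) * suc k                   ≡⟨ cong (_* suc k) (ℕₚ.+-identityʳ (tally g k)) ⟩
      tally g k * suc k                         ≤⟨ ℕₚ.*-monoˡ-≤ (suc k) (tally-5*+ g av q 3 2 (tally-3 (shift (q * 5) g) (avoids-shift (q * 5) av₁))) ⟩
      (q * 2 + 2) * suc k                       ≤⟨ long-block-density q 1≤q ⟩
      (q * 2 + 1) * (k + 4)                     ∎
      where open ℕₚ.≤-Reasoning

window : Subsetℤ → ℕ → ℕ → Bool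
window A N i = A (ℤ.- (+ N) ℤ.+ + i)

avoids-window : ∀ S A → Independent S A → ∀ d → d ∈ S → ∀ N → Avoids d (window A N)
avoids-window S A ind d d∈S N n An = by-value (window A N (d + n)) refl
  where
  distance : ∀ (x d n : ℤ) → (x ℤ.+ (d ℤ.+ n)) ℤ.- (x ℤ.+ n) ≡ d
  distance = ℤ-Solver.solve-∀
  by-value : ∀ b → window A N (d + n) ≡ b → window A N (d + n) ≡ false
  by-value false eq = eq
  by-value true  eq = ⊥-elim (ind _ _ eq An (subst (_∈ S) (sym (cong ℤ.∣_∣ (distance (ℤ.- (+ N)) (+ d) (+ n)))) d∈S))

count-window : ∀ A N → count A N ≡ tally (window A N) (suc (2 * N))
count-window A zero    = sym (ℕₚ.+-identityʳ _)
count-window A (suc N) = begin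
  count A N + b2n (A (+ suc N)) + b2n (A -[1+ N ])
    ≡⟨ cong (λ x → x + b2n (A (+ suc N)) + b2n (A -[1+ N ])) (count-window A N) ⟩
  tally (window A N) L + b2n (A (+ suc N)) + b2n (A -[1+ N ])
    ≡⟨ rotate (tally (window A N) L) _ _ ⟩
  b2n (A -[1+ N ]) + (tally (window A N) L + b2n (A (+ suc N)))
    ≡⟨ cong₂ (λ x y → b2n (A x) + (y + b2n (A (+ suc N)))) left-end
             (tally-cong (window A N) (shift 1 W) L (λ i _ → cong A (sym (shift-window (+ N) (+ i))))) ⟩
  b2n (W 0) + (tally (shift 1 W) L + b2n (A (+ suc N)))
    ≡⟨ cong (λ x → b2n (W 0) + (tally (shift 1 W) L + b2n (A x))) right-end ⟩
  b2n (W 0) + (tally (shift 1 W) L + b2n (shift 1 W L))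
    ≡⟨ cong (_+_ (b2n (W 0))) (tally-suc (shift 1 W) L) ⟨
  tally W (suc (suc L))
    ≡⟨ cong (λ x → tally W (suc x)) (double-suc N) ⟨
  tally W (suc (2 * suc N)) ∎
  where
  open ≡-Reasoning
  L = suc (2 * N)
  W = window A (suc N)
  rotate : ∀ c a b → c + a + b ≡ b + (c + a)
  rotate = ℕ-Solver.solve-∀
  double-suc : ∀ N → 2 * suc N ≡ suc (suc (2 * N))
  double-suc = ℕ-Solver.solve-∀
  double : ∀ N → 2 * N ≡ N + N
  double = ℕ-Solver.solve-∀
  shift-window : ∀ (N i : ℤ) → ℤ.- (+ 1 ℤ.+ N) ℤ.+ (+ 1 ℤ.+ i) ≡ ℤ.- N ℤ.+ i
  shift-window = ℤ-Solver.solve-∀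
  last : ∀ (N : ℤ) → ℤ.- (+ 1 ℤ.+ N) ℤ.+ (+ 1 ℤ.+ (+ 1 ℤ.+ (N ℤ.+ N))) ≡ ℤ.+ 1 ℤ.+ N
  last = ℤ-Solver.solve-∀
  left-end : -[1+ N ] ≡ ℤ.- (+ suc N) ℤ.+ + 0
  left-end = sym (ℤₚ.+-identityʳ _)
  right-end : + suc N ≡ ℤ.- (+ suc N) ℤ.+ + suc L
  right-end = sym (trans (cong (λ x → ℤ.- (+ suc N) ℤ.+ + suc (suc x)) (double N)) (last (+ N)))

avoids₁₄ₖ-window : ∀ k A → Independent (1 ∷ 4 ∷ k ∷ []) A → ∀ N → Avoids₁₄ₖ k (window A N)
avoids₁₄ₖ-window k A ind N =
  (avoids-window _ A ind 1 (here refl) N , avoids-window _ A ind 4 (there (here refl)) N) ,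
  avoids-window _ A ind k (there (there (here refl))) N

count-sparse : ∀ k P c B → (∀ g → Avoids₁₄ₖ k g → SparseStart P c B g) →
               ∀ A → Independent (1 ∷ 4 ∷ k ∷ []) A → ∀ N → count A N * P ≤ c * suc (2 * N) + B * P
count-sparse k P c B sparse A ind N = subst (λ x → x * P ≤ c * suc (2 * N) + B * P) (sym (count-window A N))
  (tally-sparse (Avoids₁₄ₖ k) (avoids₁₄ₖ-shift k) P c B sparse (suc (2 * N)) (window A N) (avoids₁₄ₖ-window k A ind N))

-- Lower bound

∧-true : ∀ {a b} → (a ∧ b) ≡ true → a ≡ true × b ≡ true
∧-true {true} eq = refl , eq

∨-true : ∀ {a b} → (a ∨ b) ≡ true → a ≡ true ⊎ b ≡ true
∨-true {true}  _  = inj₁ refl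
∨-true {false} eq = inj₂ eq

∨-introʳ : ∀ a {b} → b ≡ true → (a ∨ b) ≡ true
∨-introʳ true  _  = refl
∨-introʳ false eq = eq

∨-introˡ : ∀ {a} b → a ≡ true → (a ∨ b) ≡ true
∨-introˡ b refl = refl

T⇒≡true : ∀ {b} → T b → b ≡ true
T⇒≡true {true} _ = refl

≡true⇒T : ∀ {b} → b ≡ true → T b
≡true⇒T refl = _

∣i-j∣-cases : ∀ i j → (ℤ.∣ i ℤ.- j ∣ ≡ ℤ.∣ ℤ.∣ i ∣ ⊖ ℤ.∣ j ∣ ∣) ⊎ (ℤ.∣ i ℤ.- j ∣ ≡ ℤ.∣ i ∣ + ℤ.∣ j ∣)
∣i-j∣-cases (+ m)    (+ n)      = inj₁ (cong ℤ.∣_∣ (ℤₚ.[+m]-[+n]≡m⊖n m n))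
∣i-j∣-cases (+ m)    -[1+ n ]   = inj₂ refl
∣i-j∣-cases -[1+ m ] (+ zero)   = inj₂ (sym (ℕₚ.+-identityʳ (suc m)))
∣i-j∣-cases -[1+ m ] (+ suc n)  = inj₂ (cong suc (sym (ℕₚ.+-suc m n)))
∣i-j∣-cases -[1+ m ] -[1+ n ]   = inj₁ (ℤₚ.∣m⊖n∣≡∣n⊖m∣ (suc n) (suc m))

⊖-cases : ∀ m n → (m ≡ ℤ.∣ m ⊖ n ∣ + n) ⊎ (n ≡ ℤ.∣ m ⊖ n ∣ + m)
⊖-cases m n with ℕₚ.≤-total m n
... | inj₁ m≤n = inj₂ (sym (trans (cong (_+ m) (ℤₚ.∣⊖∣-≤ m≤n)) (ℕₚ.m∸n+n≡m m≤n)))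
... | inj₂ n≤m = inj₁ (sym (trans (cong (_+ n) (trans (ℤₚ.∣m⊖n∣≡∣n⊖m∣ m n) (ℤₚ.∣⊖∣-≤ n≤m))) (ℕₚ.m∸n+n≡m n≤m)))

%-+ʳ : ∀ d n P .{{_ : NonZero P}} → (d + n) % P ≡ (d + n % P) % P
%-+ʳ d n P = trans (%-distribˡ-+ d n P)
  (sym (trans (%-distribˡ-+ d (n % P) P) (cong (λ x → (d % P + x) % P) (m%n%n≡m%n n P))))

CyclicallyAvoids : List ℕ → (P : ℕ) .{{_ : NonZero P}} → (ℕ → Bool) → Set
CyclicallyAvoids S P R = ∀ d → d ∈ S → ∀ x → x < P → R x ≡ true → R ((d + x) % P) ≡ true → ⊥

-- The set {i : |i| ≥ M, R (|i| mod P)}: the offset M > k keeps the two half-lines apart.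
module PeriodicSet (S : List ℕ) (k : ℕ) (bounded : ∀ d → d ∈ S → d ≤ k)
                   (P : ℕ) .{{_ : NonZero P}} (R : ℕ → Bool) (cyclic : CyclicallyAvoids S P R) where

  M : ℕ
  M = P * suc k

  half : ℕ → Bool
  half m = (M ≤ᵇ m) ∧ R (m % P)

  set : Subsetℤ
  set i = half ℤ.∣ i ∣

  half-≥M : ∀ m → half m ≡ true → M ≤ m
  half-≥M m hm = ℕₚ.≤ᵇ⇒≤ M m (≡true⇒T (proj₁ (∧-true hm)))

  half-avoids : ∀ d → d ∈ S → ∀ n → half n ≡ true → half (d + n) ≡ true → ⊥
  half-avoids d d∈S n hn hdn = cyclic d d∈S (n % P) (m%n<n n P) (proj₂ (∧-true hn))
    (subst (λ x → R x ≡ true) (%-+ʳ d n P) (proj₂ (∧-true {M ≤ᵇ (d + n)} hdn)))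

  independent : Independent S set
  independent i j si sj d∈S with ∣i-j∣-cases i j
  ... | inj₂ opposite = ℕₚ.<-irrefl refl (begin-strict
        ℤ.∣ i ℤ.- j ∣       ≤⟨ bounded _ d∈S ⟩
        k                  <⟨ ℕₚ.<-≤-trans (ℕₚ.n<1+n k) (ℕₚ.m≤n*m (suc k) P) ⟩
        M                  ≤⟨ ℕₚ.m≤m+n M M ⟩
        M + M              ≤⟨ ℕₚ.+-mono-≤ (half-≥M ℤ.∣ i ∣ si) (half-≥M ℤ.∣ j ∣ sj) ⟩
        ℤ.∣ i ∣ + ℤ.∣ j ∣  ≡⟨ opposite ⟨
        ℤ.∣ i ℤ.- j ∣       ∎)
    where open ℕₚ.≤-Reasoning
  ... | inj₁ same with ⊖-cases ℤ.∣ i ∣ ℤ.∣ j ∣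
  ...   | inj₁ e = half-avoids _ (subst (_∈ S) same d∈S) ℤ.∣ j ∣ sj (subst (λ x → half x ≡ true) e si)
  ...   | inj₂ e = half-avoids _ (subst (_∈ S) same d∈S) ℤ.∣ i ∣ si (subst (λ x → half x ≡ true) e sj)

  count-set : ∀ N → count set N ≡ 2 * tally half (suc N)
  count-set zero with half 0 in h0
  ... | false = refl
  ... | true  = ⊥-elim (ℕₚ.<⇒≱ (ℕₚ.<-≤-trans (ℕ.>-nonZero⁻¹ P) (ℕₚ.m≤m*n P (suc k))) (half-≥M 0 h0))
  count-set (suc N) = trans (cong (λ x → x + b2n (half (suc N)) + b2n (half (suc N))) (count-set N))
    (trans (double (tally half (suc N)) (b2n (half (suc N)))) (cong (2 *_) (sym (tally-suc half (suc N)))))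
    where
    double : ∀ x y → 2 * x + y + y ≡ 2 * (x + y)
    double = ℕ-Solver.solve-∀

  tally-half : ∀ T → T * tally R P ≤ tally half (M + T * P)
  tally-half T = begin
    T * tally R P                  ≡⟨ cong (T *_) (tally-cong R periodic P (λ i i<P → cong R (sym (m<n⇒m%n≡m i<P)))) ⟩
    T * tally periodic P           ≡⟨ tally-periodic periodic P (λ i → cong R (trans (cong (_% P) (ℕₚ.+-comm P i)) ([m+n]%n≡m%n i P))) T ⟨
    tally periodic (T * P)         ≡⟨ tally-cong (shift M half) periodic (T * P) (λ i _ → shift-half i) ⟨
    tally (shift M half) (T * P)   ≤⟨ ℕₚ.m≤n+m _ (tally half M) ⟩
    tally half M + tally (shift M half) (T * P) ≡⟨ tally-+ half M (T * P) ⟨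
    tally half (M + T * P)         ∎
    where
    open ℕₚ.≤-Reasoning
    periodic : ℕ → Bool
    periodic i = R (i % P)
    shift-half : ∀ i → shift M half i ≡ periodic i
    shift-half i rewrite T⇒≡true (ℕₚ.≤⇒≤ᵇ (ℕₚ.m≤m+n M i)) =
      cong R (trans (cong (_% P) (trans (ℕₚ.+-comm M i) (cong (_+_ i) (ℕₚ.*-comm P (suc k)))))
                    ([m+kn]%n≡m%n i (suc k) P))

  count-often : ∀ c → c ≤ tally R P → ∀ T →
                ∃[ N ] (T ≤ N × c * suc (2 * N) ≤ P * count set N + c * suc (2 * M))
  count-often c c≤R T = N , ℕₚ.≤-trans (ℕₚ.m≤m*n T P) (ℕₚ.m≤n+m (T * P) M) , (begin
    c * suc (2 * N)                           ≡⟨ regroup c M T P ⟩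
    P * (2 * (T * c)) + c * suc (2 * M)        ≤⟨ ℕₚ.+-monoˡ-≤ _ (ℕₚ.*-monoʳ-≤ P (ℕₚ.*-monoʳ-≤ 2 T-blocks)) ⟩
    P * (2 * tally half (suc N)) + c * suc (2 * M) ≡⟨ cong (λ x → P * x + c * suc (2 * M)) (count-set N) ⟨
    P * count set N + c * suc (2 * M)          ∎)
    where
    open ℕₚ.≤-Reasoning
    N = M + T * P
    regroup : ∀ c M T P → c * suc (2 * (M + T * P)) ≡ P * (2 * (T * c)) + c * suc (2 * M)
    regroup = ℕ-Solver.solve-∀
    T-blocks : T * c ≤ tally half (suc N)
    T-blocks = ℕₚ.≤-trans (ℕₚ.*-monoʳ-≤ T c≤R)
      (ℕₚ.≤-trans (tally-half T) (subst (tally half N ≤_) (cong (tally half) (ℕₚ.+-comm N 1)) (tally-≤-+ half N 1)))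

InnerAvoids : ℕ → ℕ → (ℕ → Bool) → Set
InnerAvoids d P R = ∀ x → d + x < P → R x ≡ true → R (d + x) ≡ true → ⊥

WrapAvoids : ℕ → ℕ → (ℕ → Bool) → Set
WrapAvoids d P R = ∀ x z → z < d → P + z ≡ d + x → R x ≡ true → R z ≡ true → ⊥

wrap-% : ∀ d x P .{{_ : NonZero P}} → d ≤ P → x < P → P ≤ d + x →
         Σ[ z ∈ ℕ ] (P + z ≡ d + x × (d + x) % P ≡ z × z < d)
wrap-% d x P d≤P x<P P≤d+x = z , P+z , %-wrap , z<d
  where
  z = d + x ∸ P
  P+z : P + z ≡ d + x
  P+z = ℕₚ.m+[n∸m]≡n P≤d+x
  z<d : z < d
  z<d = ℕₚ.+-cancelʳ-< P z d (subst (_< d + P) (sym (trans (ℕₚ.+-comm z P) P+z)) (ℕₚ.+-monoʳ-< d x<P))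
  %-wrap : (d + x) % P ≡ z
  %-wrap = trans (cong (_% P) (sym P+z)) (trans (cong (_% P) (ℕₚ.+-comm P z))
             (trans ([m+n]%n≡m%n z P) (m<n⇒m%n≡m (ℕₚ.<-≤-trans z<d d≤P))))

cyclically-avoids-distance : ∀ d P .{{_ : NonZero P}} R → d ≤ P → InnerAvoids d P R → WrapAvoids d P R →
                             ∀ x → x < P → R x ≡ true → R ((d + x) % P) ≡ true → ⊥
cyclically-avoids-distance d P R d≤P inner wrap x x<P Rx Ry with d + x ℕₚ.<? P
... | yes d+x<P = inner x d+x<P Rx (subst (λ y → R y ≡ true) (m<n⇒m%n≡m d+x<P) Ry)
... | no  d+x≮P with wrap-% d x P d≤P x<P (ℕₚ.≮⇒≥ d+x≮P)
...   | z , P+z , %-wrap , z<d = wrap x z z<d P+z Rx (subst (λ y → R y ≡ true) %-wrap Ry)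

-- Modulo k + 1 the distance k is the distance 1 read backwards.
cyclically-avoids-14k : ∀ k → 4 ≤ k → ∀ R →
  InnerAvoids 1 (suc k) R → InnerAvoids 4 (suc k) R → WrapAvoids 1 (suc k) R → WrapAvoids 4 (suc k) R →
  CyclicallyAvoids (1 ∷ 4 ∷ k ∷ []) (suc k) R
cyclically-avoids-14k k 4≤k R inner₁ inner₄ wrap₁ wrap₄ _ (here refl) =
  cyclically-avoids-distance 1 (suc k) R (s≤s z≤n) inner₁ wrap₁
cyclically-avoids-14k k 4≤k R inner₁ inner₄ wrap₁ wrap₄ _ (there (here refl)) =
  cyclically-avoids-distance 4 (suc k) R (ℕₚ.m≤n⇒m≤1+n 4≤k) inner₄ wrap₄
cyclically-avoids-14k k 4≤k R inner₁ inner₄ wrap₁ wrap₄ _ (there (there (here refl))) zero _ R0 Rk =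
  wrap₁ k 0 (s≤s z≤n) (ℕₚ.+-identityʳ (suc k))
    (subst (λ y → R y ≡ true) (trans (cong (_% suc k) (ℕₚ.+-identityʳ k)) (m<n⇒m%n≡m (ℕₚ.n<1+n k))) Rk) R0
cyclically-avoids-14k k 4≤k R inner₁ inner₄ wrap₁ wrap₄ _ (there (there (here refl))) (suc x) (s≤s x<k) Rx Ry =
  inner₁ x (s≤s x<k) (subst (λ y → R y ≡ true) back Ry) Rx
  where
  back : (k + suc x) % suc k ≡ x
  back = trans (cong (_% suc k) (trans (ℕₚ.+-suc k x) (ℕₚ.+-comm (suc k) x)))
           (trans ([m+n]%n≡m%n x (suc k)) (m<n⇒m%n≡m (ℕₚ.<-trans x<k (ℕₚ.n<1+n k))))

-- The extremal patterns

residue-0-3 : ℕ → Bool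
residue-0-3 0 = true
residue-0-3 3 = true
residue-0-3 _ = false

Q₅ : ℕ → Bool
Q₅ x = residue-0-3 (x % 5)

residue-0-3-true : ∀ r → residue-0-3 r ≡ true → r ≡ 0 ⊎ r ≡ 3
residue-0-3-true 0 _ = inj₁ refl
residue-0-3-true 3 _ = inj₂ refl
residue-0-3-true 1 ()
residue-0-3-true 2 ()
residue-0-3-true (suc (suc (suc (suc r)))) ()

Q₅-periodic : ∀ x q → Q₅ (x + q * 5) ≡ Q₅ x
Q₅-periodic x q = cong residue-0-3 ([m+kn]%n≡m%n x q 5)

tally-Q₅ : ∀ q → tally Q₅ (q * 5) ≡ q * 2
tally-Q₅ = tally-periodic Q₅ 5 (λ i → trans (cong Q₅ (ℕₚ.+-comm 5 i)) (Q₅-periodic i 1))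

Q₅-+ : ∀ x → Q₅ x ≡ true → ∀ d → (d + x) % 5 ≡ (d + 0) % 5 ⊎ (d + x) % 5 ≡ (d + 3) % 5
Q₅-+ x Qx d with residue-0-3-true (x % 5) Qx
... | inj₁ x≡0 = inj₁ (trans (%-+ʳ d x 5) (cong (λ r → (d + r) % 5) x≡0))
... | inj₂ x≡3 = inj₂ (trans (%-+ʳ d x 5) (cong (λ r → (d + r) % 5) x≡3))

Q₅-avoids : ∀ d → Q₅ (d + 0) ≡ false → Q₅ (d + 3) ≡ false → ∀ x → Q₅ x ≡ true → Q₅ (d + x) ≡ true → ⊥
Q₅-avoids d d∉Q d+3∉Q x Qx Qdx with Q₅-+ x Qx d
... | inj₁ r with trans (sym d∉Q) (trans (sym (cong residue-0-3 r)) Qdx)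
...   | ()
Q₅-avoids d d∉Q d+3∉Q x Qx Qdx | inj₂ r with trans (sym d+3∉Q) (trans (sym (cong residue-0-3 r)) Qdx)
...   | ()

Q₅-sum : ∀ j x t q → j + x ≡ t + q * 5 → Q₅ x ≡ true → (j + 0) % 5 ≡ t % 5 ⊎ (j + 3) % 5 ≡ t % 5
Q₅-sum j x t q eq Qx = ⊎-map (λ r → trans (sym r) j+x) (λ r → trans (sym r) j+x) (Q₅-+ x Qx j)
  where
  j+x : (j + x) % 5 ≡ t % 5
  j+x = trans (cong (_% 5) eq) ([m+kn]%n≡m%n t q 5)

Q₅-below : ℕ → ℕ → Bool
Q₅-below n x = (x <ᵇ n) ∧ Q₅ x

Q₅-below-sound : ∀ n x → Q₅-below n x ≡ true → x < n × Q₅ x ≡ true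
Q₅-below-sound n x e with ∧-true {x <ᵇ n} e
... | x<n , Qx = ℕₚ.<ᵇ⇒< x n (≡true⇒T x<n) , Qx

Q₅-below-complete : ∀ n x → x < n → Q₅ x ≡ true → Q₅-below n x ≡ true
Q₅-below-complete n x x<n Qx rewrite T⇒≡true (ℕₚ.<⇒<ᵇ x<n) = Qx

tally-∋ : ∀ f L i → i < L → f i ≡ true → 1 ≤ tally f L
tally-∋ f (suc L) zero    _         fi rewrite fi = s≤s z≤n
tally-∋ f (suc L) (suc i) (s≤s i<L) fi = ℕₚ.≤-trans (tally-∋ (λ j → f (suc j)) L i i<L fi) (ℕₚ.m≤n+m _ (b2n (f 0)))

tally-⊇-Q₅-below : ∀ q R → (∀ x → x < q * 5 → Q₅ x ≡ true → R x ≡ true) →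
                   ∀ L c → c ≤ tally (shift (q * 5) R) L → q * 2 + c ≤ tally R (q * 5 + L)
tally-⊇-Q₅-below q R Q₅⊆R L c tail = begin
  q * 2 + c                                   ≤⟨ ℕₚ.+-monoʳ-≤ (q * 2) tail ⟩
  q * 2 + tally (shift (q * 5) R) L            ≡⟨ cong (_+ tally (shift (q * 5) R) L) (tally-Q₅ q) ⟨
  tally Q₅ (q * 5) + tally (shift (q * 5) R) L ≤⟨ ℕₚ.+-monoˡ-≤ _ (tally-mono Q₅ R (q * 5) Q₅⊆R) ⟩
  tally R (q * 5) + tally (shift (q * 5) R) L  ≡⟨ tally-+ R (q * 5) L ⟨
  tally R (q * 5 + L)                          ∎
  where open ℕₚ.≤-Reasoning

wrap-≥ : ∀ {k z d x} → suc k + z ≡ d + x → d ≤ suc z → k ≤ x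
wrap-≥ {k} {z} {d} {x} eq d≤1+z = ℕₚ.+-cancelˡ-≤ d k x (begin
  d + k      ≡⟨ ℕₚ.+-comm d k ⟩
  k + d      ≤⟨ ℕₚ.+-monoʳ-≤ k d≤1+z ⟩
  k + suc z  ≡⟨ ℕₚ.+-suc k z ⟩
  suc k + z  ≡⟨ eq ⟩
  d + x      ∎)
  where open ℕₚ.≤-Reasoning

Q₅-multiple : ∀ q → Q₅ (q * 5 + 0) ≡ true
Q₅-multiple q = trans (cong Q₅ (ℕₚ.+-identityʳ (q * 5))) (Q₅-periodic 0 q)

module Pattern-5q (q : ℕ) (4≤k : 4 ≤ q * 5) where

  k : ℕ
  k = q * 5

  R : ℕ → Bool
  R = Q₅-below k

  cyclic : CyclicallyAvoids (1 ∷ 4 ∷ k ∷ []) (suc k) R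
  cyclic = cyclically-avoids-14k k 4≤k R inner₁ inner₄ wrap₁ wrap₄
    where
    in-Q₅ : ∀ x → R x ≡ true → Q₅ x ≡ true
    in-Q₅ x Rx = proj₂ (Q₅-below-sound k x Rx)
    below : ∀ x → R x ≡ true → x < k
    below x Rx = proj₁ (Q₅-below-sound k x Rx)
    inner₁ : InnerAvoids 1 (suc k) R
    inner₁ x _ Rx Ry = Q₅-avoids 1 refl refl x (in-Q₅ x Rx) (in-Q₅ (1 + x) Ry)
    inner₄ : InnerAvoids 4 (suc k) R
    inner₄ x _ Rx Ry = Q₅-avoids 4 refl refl x (in-Q₅ x Rx) (in-Q₅ (4 + x) Ry)
    wrap₁ : WrapAvoids 1 (suc k) R
    wrap₁ x zero _ eq Rx _ = ℕₚ.<⇒≱ (below x Rx) (wrap-≥ eq ℕₚ.≤-refl)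
    wrap₁ x (suc z) (s≤s ()) _ _ _
    wrap₄ : WrapAvoids 4 (suc k) R
    wrap₄ x 0 _ eq Rx _ with Q₅-sum 4 x 1 q (trans (sym eq) (cong suc (ℕₚ.+-identityʳ k))) (in-Q₅ x Rx)
    ... | inj₁ ()
    ... | inj₂ ()
    wrap₄ x 1 _ _ _ R1 with in-Q₅ 1 R1
    ... | ()
    wrap₄ x 2 _ _ _ R2 with in-Q₅ 2 R2
    ... | ()
    wrap₄ x 3 _ eq Rx _ = ℕₚ.<⇒≱ (below x Rx) (wrap-≥ eq ℕₚ.≤-refl)
    wrap₄ x (suc (suc (suc (suc z)))) (s≤s (s≤s (s≤s (s≤s ())))) _ _ _

  dense : q * 2 ≤ tally R (suc k)
  dense = subst₂ _≤_ (ℕₚ.+-identityʳ (q * 2)) (cong (tally R) (ℕₚ.+-comm k 1))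
    (tally-⊇-Q₅-below q R (Q₅-below-complete k) 1 0 z≤n)

module Pattern-5q+2 (q : ℕ) (4≤k : 4 ≤ q * 5 + 2) where

  k : ℕ
  k = q * 5 + 2

  R : ℕ → Bool
  R = Q₅-below (q * 5 + 1)

  cyclic : CyclicallyAvoids (1 ∷ 4 ∷ k ∷ []) (suc k) R
  cyclic = cyclically-avoids-14k k 4≤k R inner₁ inner₄ wrap₁ wrap₄
    where
    in-Q₅ : ∀ x → R x ≡ true → Q₅ x ≡ true
    in-Q₅ x Rx = proj₂ (Q₅-below-sound (q * 5 + 1) x Rx)
    below : ∀ x → R x ≡ true → x < k
    below x Rx = ℕₚ.<-trans (proj₁ (Q₅-below-sound (q * 5 + 1) x Rx)) (ℕₚ.+-monoʳ-< (q * 5) (s≤s (s≤s z≤n)))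
    end : ∀ q → suc (q * 5 + 2 + 0) ≡ 3 + q * 5
    end = ℕ-Solver.solve-∀
    inner₁ : InnerAvoids 1 (suc k) R
    inner₁ x _ Rx Ry = Q₅-avoids 1 refl refl x (in-Q₅ x Rx) (in-Q₅ (1 + x) Ry)
    inner₄ : InnerAvoids 4 (suc k) R
    inner₄ x _ Rx Ry = Q₅-avoids 4 refl refl x (in-Q₅ x Rx) (in-Q₅ (4 + x) Ry)
    wrap₁ : WrapAvoids 1 (suc k) R
    wrap₁ x zero _ eq Rx _ = ℕₚ.<⇒≱ (below x Rx) (wrap-≥ eq ℕₚ.≤-refl)
    wrap₁ x (suc z) (s≤s ()) _ _ _
    wrap₄ : WrapAvoids 4 (suc k) R
    wrap₄ x 0 _ eq Rx _ with Q₅-sum 4 x 3 q (trans (sym eq) (end q)) (in-Q₅ x Rx)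
    ... | inj₁ ()
    ... | inj₂ ()
    wrap₄ x 1 _ _ _ R1 with in-Q₅ 1 R1
    ... | ()
    wrap₄ x 2 _ _ _ R2 with in-Q₅ 2 R2
    ... | ()
    wrap₄ x 3 _ eq Rx _ = ℕₚ.<⇒≱ (below x Rx) (wrap-≥ eq ℕₚ.≤-refl)
    wrap₄ x (suc (suc (suc (suc z)))) (s≤s (s≤s (s≤s (s≤s ())))) _ _ _

  dense : q * 2 + 1 ≤ tally R (suc k)
  dense = subst (q * 2 + 1 ≤_) (cong (tally R) (ℕₚ.+-suc (q * 5) 2))
    (tally-⊇-Q₅-below q R (λ x x<q5 → Q₅-below-complete (q * 5 + 1) x (ℕₚ.<-≤-trans x<q5 (ℕₚ.m≤m+n (q * 5) 1))) 3 1
      (tally-∋ (shift (q * 5) R) 3 0 (s≤s z≤n)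
        (Q₅-below-complete (q * 5 + 1) (q * 5 + 0) (ℕₚ.+-monoʳ-< (q * 5) (s≤s z≤n)) (Q₅-multiple q))))

module Pattern-5q+3 (q : ℕ) (1≤q : 1 ≤ q) where

  k : ℕ
  k = q * 5 + 3

  R : ℕ → Bool
  R x = Q₅-below (q * 5) x ∨ (x ≡ᵇ q * 5 + 1)

  R-sound : ∀ x → R x ≡ true → (x < q * 5 × Q₅ x ≡ true) ⊎ x ≡ q * 5 + 1
  R-sound x Rx with ∨-true {Q₅-below (q * 5) x} Rx
  ... | inj₁ Qx = inj₁ (Q₅-below-sound (q * 5) x Qx)
  ... | inj₂ e  = inj₂ (ℕₚ.≡ᵇ⇒≡ x (q * 5 + 1) (≡true⇒T e))

  below : ∀ x → R x ≡ true → x < k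
  below x Rx with R-sound x Rx
  ... | inj₁ (x<q5 , _) = ℕₚ.<-≤-trans x<q5 (ℕₚ.m≤m+n (q * 5) 3)
  ... | inj₂ refl       = ℕₚ.+-monoʳ-< (q * 5) (s≤s (s≤s z≤n))

  wrapped : ∀ q z → 4 + (q * 5 + z) ≡ suc (q * 5 + 3) + z
  wrapped = ℕ-Solver.solve-∀

  4≤k : 4 ≤ k
  4≤k = ℕₚ.≤-trans (s≤s (s≤s (s≤s (s≤s z≤n)))) (ℕₚ.+-monoˡ-≤ 3 (ℕₚ.*-monoˡ-≤ 5 1≤q))

  cyclic : CyclicallyAvoids (1 ∷ 4 ∷ k ∷ []) (suc k) R
  cyclic = cyclically-avoids-14k k 4≤k R inner₁ inner₄ wrap₁ wrap₄
    where
    inner₁ : InnerAvoids 1 (suc k) R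
    inner₁ x _ Rx Ry with R-sound x Rx | R-sound (1 + x) Ry
    ... | inj₁ (_ , Qx)   | inj₁ (_ , Qy)   = Q₅-avoids 1 refl refl x Qx Qy
    ... | inj₁ (x<q5 , _) | inj₂ e          = ℕₚ.<-irrefl (ℕₚ.suc-injective (trans e (ℕₚ.+-comm (q * 5) 1))) x<q5
    ... | inj₂ refl       | inj₁ (y<q5 , _) = ℕₚ.<⇒≱ y<q5 (ℕₚ.≤-trans (ℕₚ.m≤m+n (q * 5) 1) (ℕₚ.n≤1+n _))
    ... | inj₂ refl       | inj₂ e          = ℕₚ.1+n≢n e
    inner₄ : InnerAvoids 4 (suc k) R
    inner₄ x 4+x<P Rx Ry with R-sound x Rx | R-sound (4 + x) Ry
    ... | inj₁ (_ , Qx) | inj₁ (_ , Qy) = Q₅-avoids 4 refl refl x Qx Qy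
    ... | inj₁ (_ , Qx) | inj₂ e with Q₅-sum 4 x 1 q (trans e (ℕₚ.+-comm (q * 5) 1)) Qx
    ...   | inj₁ ()
    ...   | inj₂ ()
    inner₄ x 4+x<P Rx Ry | inj₂ refl | _ =
      ℕₚ.<⇒≱ 4+x<P (ℕₚ.≤-trans (ℕₚ.≤-reflexive (regroup q)) (ℕₚ.n≤1+n _))
      where
      regroup : ∀ q → suc (q * 5 + 3) ≡ 3 + (q * 5 + 1)
      regroup = ℕ-Solver.solve-∀
    wrap₁ : WrapAvoids 1 (suc k) R
    wrap₁ x zero _ eq Rx _ = ℕₚ.<⇒≱ (below x Rx) (wrap-≥ eq ℕₚ.≤-refl)
    wrap₁ x (suc z) (s≤s ()) _ _ _
    wrap₄ : WrapAvoids 4 (suc k) R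
    wrap₄ x z z<4 eq Rx Rz with R-sound z Rz
    ... | inj₂ refl = ℕₚ.<⇒≱ z<4 (ℕₚ.≤-trans (s≤s (s≤s (s≤s (s≤s z≤n)))) (ℕₚ.+-monoˡ-≤ 1 (ℕₚ.*-monoˡ-≤ 5 1≤q)))
    ... | inj₁ (_ , Qz) with R-sound x Rx
    ...   | inj₁ (x<q5 , _) = ℕₚ.<⇒≱ x<q5 (subst (q * 5 ≤_) x≡q5+z (ℕₚ.m≤m+n (q * 5) z))
      where
      x≡q5+z : q * 5 + z ≡ x
      x≡q5+z = ℕₚ.+-cancelˡ-≡ 4 (q * 5 + z) x (trans (wrapped q z) eq)
    ...   | inj₂ refl with subst (λ y → Q₅ y ≡ true) (ℕₚ.+-cancelˡ-≡ (q * 5) z 1 x≡q5+z) Qz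
      where
      x≡q5+z : q * 5 + z ≡ q * 5 + 1
      x≡q5+z = ℕₚ.+-cancelˡ-≡ 4 (q * 5 + z) (q * 5 + 1) (trans (wrapped q z) eq)
    ...     | ()

  dense : q * 2 + 1 ≤ tally R (suc k)
  dense = subst (q * 2 + 1 ≤_) (cong (tally R) (ℕₚ.+-suc (q * 5) 3))
    (tally-⊇-Q₅-below q R (λ x x<q5 Qx → ∨-introˡ _ (Q₅-below-complete (q * 5) x x<q5 Qx)) 4 1
      (tally-∋ (shift (q * 5) R) 4 1 (s≤s (s≤s z≤n))
        (∨-introʳ (Q₅-below (q * 5) (q * 5 + 1)) (T⇒≡true (ℕₚ.≡⇒≡ᵇ (q * 5 + 1) (q * 5 + 1) refl)))))

toℚᵘ-/ : ∀ (i : ℤ) (d : ℕ) → toℚᵘ (i / suc d) ℚᵘ.≃ mkℚᵘ i d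
toℚᵘ-/ i d = ℚₚ.toℚᵘ-fromℚᵘ (mkℚᵘ i d)

positive-numerator : ∀ (ε : ℚ) → 0ℚ ℚ.< ε → Σ[ n ∈ ℕ ] Σ[ d ∈ ℕ ] (toℚᵘ ε ≡ mkℚᵘ (+ suc n) d)
positive-numerator (mkℚ (+ zero)   d _) 0<ε with ℚₚ.toℚᵘ-mono-< 0<ε
... | ℚᵘ.*<* (ℤ.+<+ ())
positive-numerator (mkℚ +[1+ n ]   d _) 0<ε = n , d , refl
positive-numerator (mkℚ -[1+ n ]   d _) 0<ε with ℚₚ.toℚᵘ-mono-< 0<ε
... | ℚᵘ.*<* ()

cross-≤ : ∀ c N a b n d → c * (suc b * suc d) ≤ (a * suc d + suc n * suc b) * suc (2 * N) →
          mkℚᵘ (+ c) (2 * N) ℚᵘ.≤ mkℚᵘ (+ a) b ℚᵘ.+ mkℚᵘ (+ suc n) d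
cross-≤ c N a b n d h = ℚᵘ.*≤* (subst₂ ℤ._≤_ (ℤₚ.pos-* c (suc b * suc d))
  (trans (ℤₚ.pos-* (a * suc d + suc n * suc b) (suc (2 * N)))
         (cong (ℤ._* + suc (2 * N)) (cong₂ ℤ._+_ (ℤₚ.pos-* a (suc d)) (ℤₚ.pos-* (suc n) (suc b)))))
  (ℤ.+≤+ h))

cross-< : ∀ c N a b n d → a * (suc (2 * N) * suc d) < (c * suc d + suc n * suc (2 * N)) * suc b →
          mkℚᵘ (+ a) b ℚᵘ.< mkℚᵘ (+ c) (2 * N) ℚᵘ.+ mkℚᵘ (+ suc n) d
cross-< c N a b n d h = ℚᵘ.*<* (subst₂ ℤ._<_ (ℤₚ.pos-* a (suc (2 * N) * suc d))
  (trans (ℤₚ.pos-* (c * suc d + suc n * suc (2 * N)) (suc b))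
         (cong (ℤ._* + suc b) (cong₂ ℤ._+_ (ℤₚ.pos-* c (suc d)) (ℤₚ.pos-* (suc n) (suc (2 * N))))))
  (ℤ.+<+ h))

-- Once C * D ≤ N the additive error C is swamped by the slack ε ≥ 1 / D.
absorb-error-≤ : ∀ c a C b D n N → suc b * c ≤ a * suc (2 * N) + C → C * D ≤ N →
                 c * (suc b * D) ≤ (a * D + suc n * suc b) * suc (2 * N)
absorb-error-≤ c a C b D n N bound C*D≤N = begin
  c * (B * D)                       ≡⟨ reorder c B D ⟩
  B * c * D                         ≤⟨ ℕₚ.*-monoˡ-≤ D bound ⟩
  (a * L + C) * D                   ≡⟨ distribute a L C D ⟩
  a * D * L + C * D                 ≤⟨ ℕₚ.+-monoʳ-≤ (a * D * L) error ⟩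
  a * D * L + suc n * B * L         ≡⟨ ℕₚ.*-distribʳ-+ L (a * D) (suc n * B) ⟨
  (a * D + suc n * B) * L           ∎
  where
  open ℕₚ.≤-Reasoning
  B = suc b
  L = suc (2 * N)
  reorder : ∀ c B D → c * (B * D) ≡ B * c * D
  reorder = ℕ-Solver.solve-∀
  distribute : ∀ a L C D → (a * L + C) * D ≡ a * D * L + C * D
  distribute = ℕ-Solver.solve-∀
  error : C * D ≤ suc n * B * L
  error = ℕₚ.≤-trans C*D≤N (ℕₚ.≤-trans (ℕₚ.≤-trans (ℕₚ.m≤m+n N (N + 0)) (ℕₚ.n≤1+n _)) (ℕₚ.m≤n*m L (suc n * B)))

absorb-error-< : ∀ c a C b D n N → a * suc (2 * N) ≤ suc b * c + C → C * D ≤ N →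
                 a * (suc (2 * N) * D) < (c * D + suc n * suc (2 * N)) * suc b
absorb-error-< c a C b D n N bound C*D≤N = begin-strict
  a * (L * D)                 ≡⟨ ℕₚ.*-assoc a L D ⟨
  a * L * D                   ≤⟨ ℕₚ.*-monoˡ-≤ D bound ⟩
  (B * c + C) * D             ≡⟨ distribute B c C D ⟩
  c * D * B + C * D           <⟨ ℕₚ.+-monoʳ-< (c * D * B) error ⟩
  c * D * B + suc n * L * B   ≡⟨ ℕₚ.*-distribʳ-+ B (c * D) (suc n * L) ⟨
  (c * D + suc n * L) * B     ∎
  where
  open ℕₚ.≤-Reasoning
  B = suc b
  L = suc (2 * N)
  distribute : ∀ B c C D → (B * c + C) * D ≡ c * D * B + C * D
  distribute = ℕ-Solver.solve-∀
  error : C * D < suc n * L * B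
  error = ℕₚ.<-≤-trans (s≤s (ℕₚ.≤-trans C*D≤N (ℕₚ.m≤m+n N (N + 0))))
            (ℕₚ.≤-trans (ℕₚ.m≤n*m L (suc n)) (ℕₚ.m≤m*n (suc n * L) B))

upperDensity≤-from-count : ∀ A a b C → (∀ N → suc b * count A N ≤ a * suc (2 * N) + C) →
                           UpperDensity≤ A (+ a / suc b)
upperDensity≤-from-count A a b C bound ε 0<ε with positive-numerator ε 0<ε
... | n , d , ε≡ = C * suc d , λ N C*D≤N →
  ℚₚ.toℚᵘ-cancel-≤ (ℚᵘₚ.≤-respˡ-≃ (ℚᵘₚ.≃-sym (toℚᵘ-/ (+ count A N) (2 * N)))
    (ℚᵘₚ.≤-respʳ-≃ (ℚᵘₚ.≃-sym bound+ε)
      (cross-≤ (count A N) N a b n d (absorb-error-≤ (count A N) a C b (suc d) n N (bound N) C*D≤N))))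
  where
  bound+ε : toℚᵘ (+ a / suc b ℚ.+ ε) ℚᵘ.≃ mkℚᵘ (+ a) b ℚᵘ.+ mkℚᵘ (+ suc n) d
  bound+ε = ℚᵘₚ.≃-trans (ℚₚ.toℚᵘ-homo-+ (+ a / suc b) ε) (ℚᵘₚ.+-cong (toℚᵘ-/ (+ a) b) (ℚᵘₚ.≃-reflexive ε≡))

density>-often-from-count : ∀ A a b C → (∀ T → ∃[ N ] (T ≤ N × a * suc (2 * N) ≤ suc b * count A N + C)) →
  ∀ ε → 0ℚ ℚ.< ε → ∀ N₀ → ∃[ N ] (N₀ ≤ N × + a / suc b ℚ.- ε ℚ.< density A N)
density>-often-from-count A a b C often ε 0<ε N₀ with positive-numerator ε 0<ε
... | n , d , ε≡ with often (N₀ + C * suc d)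
... | N , T≤N , bound = N , ℕₚ.≤-trans (ℕₚ.m≤m+n N₀ _) T≤N ,
  subst (+ a / suc b ℚ.- ε ℚ.<_) cancel (ℚₚ.+-monoˡ-< (ℚ.- ε) below)
  where
  δ = density A N
  cancel : (δ ℚ.+ ε) ℚ.+ ℚ.- ε ≡ δ
  cancel = trans (ℚₚ.+-assoc δ ε (ℚ.- ε)) (trans (cong (δ ℚ.+_) (ℚₚ.+-inverseʳ ε)) (ℚₚ.+-identityʳ δ))
  δ+ε : toℚᵘ (δ ℚ.+ ε) ℚᵘ.≃ mkℚᵘ (+ count A N) (2 * N) ℚᵘ.+ mkℚᵘ (+ suc n) d
  δ+ε = ℚᵘₚ.≃-trans (ℚₚ.toℚᵘ-homo-+ δ ε) (ℚᵘₚ.+-cong (toℚᵘ-/ (+ count A N) (2 * N)) (ℚᵘₚ.≃-reflexive ε≡))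
  below : + a / suc b ℚ.< δ ℚ.+ ε
  below = ℚₚ.toℚᵘ-cancel-< (ℚᵘₚ.<-respˡ-≃ (ℚᵘₚ.≃-sym (toℚᵘ-/ (+ a) b))
    (ℚᵘₚ.<-respʳ-≃ (ℚᵘₚ.≃-sym δ+ε)
      (cross-< (count A N) N a b n d (absorb-error-< (count A N) a C b (suc d) n N bound
        (ℕₚ.≤-trans (ℕₚ.m≤n+m _ N₀) T≤N)))))

independence-ratio : ∀ k → 4 ≤ k → ∀ P .{{_ : NonZero P}} c B m a b → suc b ≡ m * P → a ≡ m * c →
  (∀ g → Avoids₁₄ₖ k g → SparseStart P c B g) →
  ∀ R → CyclicallyAvoids (1 ∷ 4 ∷ k ∷ []) P R → c ≤ tally R P →
  IsIndependenceRatio (1 ∷ 4 ∷ k ∷ []) (+ a / suc b)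
independence-ratio k 4≤k P c B m a b b≡ a≡ sparse R cyclic dense =
  (λ A ind → upperDensity≤-from-count A a b (m * (B * P)) (upper A ind)) ,
  (λ ε 0<ε → set , independent , density>-often-from-count set a b (m * (c * suc (2 * M))) lower ε 0<ε)
  where
  bounded : ∀ d → d ∈ (1 ∷ 4 ∷ k ∷ []) → d ≤ k
  bounded _ (here refl)                 = ℕₚ.≤-trans (s≤s z≤n) 4≤k
  bounded _ (there (here refl))         = 4≤k
  bounded _ (there (there (here refl))) = ℕₚ.≤-refl
  open PeriodicSet (1 ∷ 4 ∷ k ∷ []) k bounded P R cyclic
  open ℕₚ.≤-Reasoning
  upper : ∀ A → Independent (1 ∷ 4 ∷ k ∷ []) A → ∀ N → suc b * count A N ≤ a * suc (2 * N) + m * (B * P)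
  upper A ind N = begin
    suc b * count A N                    ≡⟨ cong (_* count A N) b≡ ⟩
    m * P * count A N                    ≡⟨ rearrange m P (count A N) ⟩
    m * (count A N * P)                  ≤⟨ ℕₚ.*-monoʳ-≤ m (count-sparse k P c B sparse A ind N) ⟩
    m * (c * suc (2 * N) + B * P)        ≡⟨ distribute m c (suc (2 * N)) (B * P) ⟩
    m * c * suc (2 * N) + m * (B * P)    ≡⟨ cong (λ x → x * suc (2 * N) + m * (B * P)) a≡ ⟨
    a * suc (2 * N) + m * (B * P)        ∎
    where
    rearrange : ∀ m P x → m * P * x ≡ m * (x * P)
    rearrange = ℕ-Solver.solve-∀
    distribute : ∀ m c L E → m * (c * L + E) ≡ m * c * L + m * E
    distribute = ℕ-Solver.solve-∀
  lower : ∀ T → ∃[ N ] (T ≤ N × a * suc (2 * N) ≤ suc b * count set N + m * (c * suc (2 * M)))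
  lower T with count-often c dense T
  ... | N , T≤N , bound = N , T≤N , (begin
    a * suc (2 * N)                            ≡⟨ cong (_* suc (2 * N)) a≡ ⟩
    m * c * suc (2 * N)                        ≡⟨ ℕₚ.*-assoc m c (suc (2 * N)) ⟩
    m * (c * suc (2 * N))                      ≤⟨ ℕₚ.*-monoʳ-≤ m bound ⟩
    m * (P * count set N + c * suc (2 * M))    ≡⟨ distribute m P (count set N) (c * suc (2 * M)) ⟩
    m * P * count set N + m * (c * suc (2 * M)) ≡⟨ cong (λ x → x * count set N + m * (c * suc (2 * M))) b≡ ⟨
    suc b * count set N + m * (c * suc (2 * M)) ∎)
    where
    distribute : ∀ m P x E → m * (P * x + E) ≡ m * P * x + m * E
    distribute = ℕ-Solver.solve-∀

five-periods : ∀ k → suc (5 * k + 4) ≡ 5 * suc k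
five-periods = ℕ-Solver.solve-∀

ratio-5q : ∀ k q → k ≡ q * 5 → 4 ≤ k →
           IsIndependenceRatio (1 ∷ 4 ∷ k ∷ []) (+ (2 * k) / suc (5 * k + 4))
ratio-5q k q refl 4≤k = independence-ratio k 4≤k (suc k) (q * 2) (suc k) 5 (2 * k) (5 * k + 4)
  (five-periods k) (numerator q) (sparse-5q q) R cyclic dense
  where
  open Pattern-5q q 4≤k using (R; cyclic; dense)
  numerator : ∀ q → 2 * (q * 5) ≡ 5 * (q * 2)
  numerator = ℕ-Solver.solve-∀

ratio-5q+2 : ∀ k q → k ≡ q * 5 + 2 → 4 ≤ k →
             IsIndependenceRatio (1 ∷ 4 ∷ k ∷ []) (+ (2 * k + 1) / suc (5 * k + 4))
ratio-5q+2 k q refl 4≤k = independence-ratio k 4≤k (suc k) (q * 2 + 1) (suc k) 5 (2 * k + 1) (5 * k + 4)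
  (five-periods k) (numerator q) (sparse-5q+2 q) R cyclic dense
  where
  open Pattern-5q+2 q 4≤k using (R; cyclic; dense)
  numerator : ∀ q → 2 * (q * 5 + 2) + 1 ≡ 5 * (q * 2 + 1)
  numerator = ℕ-Solver.solve-∀

ratio-5q+3 : ∀ k q → k ≡ q * 5 + 3 → 1 ≤ q →
             IsIndependenceRatio (1 ∷ 4 ∷ k ∷ []) (+ (2 * k ∸ 1) / suc (5 * k + 4))
ratio-5q+3 k q refl 1≤q = independence-ratio k 4≤k (suc k) (q * 2 + 1) (k + 4) 5 (2 * k ∸ 1) (5 * k + 4)
  (five-periods k) (cong (_∸ 1) (numerator q)) (sparse-5q+3 q 1≤q) R cyclic dense
  where
  open Pattern-5q+3 q 1≤q using (R; cyclic; dense; 4≤k)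
  numerator : ∀ q → 2 * (q * 5 + 3) ≡ suc (5 * (q * 2 + 1))
  numerator = ℕ-Solver.solve-∀

Q₅-+-% : ∀ k j → Q₅ (k + j) ≡ residue-0-3 ((k % 5 + j) % 5)
Q₅-+-% k j = cong residue-0-3 (trans (cong (_% 5) (ℕₚ.+-comm k j))
  (trans (%-+ʳ j k 5) (cong (_% 5) (ℕₚ.+-comm j (k % 5)))))

ratio-2/5 : ∀ k → 4 ≤ k → k % 5 ≡ 1 ⊎ k % 5 ≡ 4 → IsIndependenceRatio (1 ∷ 4 ∷ k ∷ []) (+ 2 / 5)
ratio-2/5 k 4≤k k%5 =
  independence-ratio k 4≤k 5 2 5 1 2 4 refl refl (λ g av → sparse-5 g (proj₁ av)) Q₅ cyclic ℕₚ.≤-refl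
  where
  avoids : ∀ d → Q₅ (d + 0) ≡ false → Q₅ (d + 3) ≡ false → ∀ x → x < 5 → Q₅ x ≡ true → Q₅ ((d + x) % 5) ≡ true → ⊥
  avoids d d∉Q₅ d+3∉Q₅ x _ Qx Qy = Q₅-avoids d d∉Q₅ d+3∉Q₅ x Qx (trans (cong residue-0-3 (sym (m%n%n≡m%n (d + x) 5))) Qy)
  outside : ∀ j r → r ≡ 1 ⊎ r ≡ 4 → j ≡ 0 ⊎ j ≡ 3 → residue-0-3 ((r + j) % 5) ≡ false
  outside _ _ (inj₁ refl) (inj₁ refl) = refl
  outside _ _ (inj₁ refl) (inj₂ refl) = refl
  outside _ _ (inj₂ refl) (inj₁ refl) = refl
  outside _ _ (inj₂ refl) (inj₂ refl) = refl
  cyclic : CyclicallyAvoids (1 ∷ 4 ∷ k ∷ []) 5 Q₅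
  cyclic _ (here refl)                 = avoids 1 refl refl
  cyclic _ (there (here refl))         = avoids 4 refl refl
  cyclic _ (there (there (here refl))) = avoids k (trans (Q₅-+-% k 0) (outside 0 (k % 5) k%5 (inj₁ refl)))
                                                  (trans (Q₅-+-% k 3) (outside 3 (k % 5) k%5 (inj₂ refl)))

theorem32 : ∀ (k : ℕ) → 4 < k → IsIndependenceRatio (1 ∷ 4 ∷ k ∷ []) (ratio14k k)
theorem32 k 4<k with k % 5 in r≡ | k ℕ./ 5 | m≡m%n+[m/n]*n k 5 | m%n<n k 5
... | 0 | q     | k≡ | _ = ratio-5q k q k≡ (ℕₚ.<⇒≤ 4<k)
... | 1 | _     | _  | _ = ratio-2/5 k (ℕₚ.<⇒≤ 4<k) (inj₁ r≡)
... | 2 | q     | k≡ | _ = ratio-5q+2 k q (trans k≡ (ℕₚ.+-comm 2 (q * 5))) (ℕₚ.<⇒≤ 4<k)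
... | 3 | zero  | k≡ | _ = ⊥-elim (ℕₚ.<⇒≱ 4<k (ℕₚ.≤-trans (ℕₚ.≤-reflexive k≡) (ℕₚ.n≤1+n 3)))
... | 3 | suc q | k≡ | _ = ratio-5q+3 k (suc q) (trans k≡ (ℕₚ.+-comm 3 (suc q * 5))) (s≤s z≤n)
... | 4 | _     | _  | _ = ratio-2/5 k (ℕₚ.<⇒≤ 4<k) (inj₂ r≡)
... | suc (suc (suc (suc (suc _)))) | _ | _ | s≤s (s≤s (s≤s (s≤s (s≤s ()))))
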